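{- Let $P$ be a program and $t$ a ground term. If $t \to_P^{m} v$ and $t \to_P^{n} w$ where $v$ and $w$ are values, then $m = n$ and $v = w$. In words: all normalising reductions of $t$ have the same length and yield the same result.
   Context: Fix a finite set of base types $B$. Simple types are $A ::= B \mid A_1\times A_2 \mid A_1\to A_2$ ($\to$ associates to the right). Let $\mathcal V$ be a countably infinite set of variables and let $\mathcal F$ (function symbols) and $\mathcal C$ (constructors) be disjoint sets of symbols, disjoint from $\mathcal V$. Every symbol carries a simple type, and every $s\in\mathcal F\cup\mathcal C$ of type $A_1\to\cdots\to A_n\to A$ has an arity $\mathrm{ar}(s)\le n$. Terms are simply typed (Church style): $t,u ::= x \mid f \mid c \mid t\,u \mid (t,u) \mid \mathtt{let}\ (x,y)=t\ \mathtt{in}\ u$ (application associates to the left; the let binds $x,y$ in $u$). A term is ground if it has no free variables and linear if each variable occurs at most once. Patterns: $p ::= x \mid c\,p_1\cdots p_n$ where $c$ has type $A_1\to\cdots\to A_n\to B$ with $B$ a base type. Values: $v ::= c\,v_1\cdots v_n \mid f\,v_1\cdots v_m \mid (v,w)$, where in the second case $f$ of type $A_1\to\cdots\to A_m\to A_{m+1}\to A$ is applied to fewer arguments than its type admits. A program $P$ is a finite set of equations $f\,p_1\cdots p_{\mathrm{ar}(f)} = r$ with $f\in\mathcal F$, both sides of the same simple type, left-hand side linear, all variables of $r$ occurring in the left-hand side, and left-hand sides of equations defining the same $f$ pairwise non-overlapping (no term is an instance of two of them). Evaluation contexts: $E ::= [\,] \mid E\,t \mid t\,E \mid (E,t) \mid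 (t,E) \mid \mathtt{let}\ (x,y)=E\ \mathtt{in}\ t$. The call-by-value reduction $\to_P$ on ground terms is the closure under evaluation contexts of the rules $(f\,p_1\cdots p_n)\theta \to_P r\theta$ whenever $f\,p_1\cdots p_n = r\in P$ and $\theta$ maps the variables of the left-hand side to values, and $\mathtt{let}\ (x,y)=(v,w)\ \mathtt{in}\ u \to_P u\{x\mapsto v, y\mapsto w\}$ for values $v,w$. $\to_P^{\ell}$ denotes the $\ell$-fold composition of $\to_P$. -}

module Defs where

open import Data.Nat using (ℕ; zero; suc; _≤_; _<_)
open import Data.Fin using (Fin)
import Data.Fin.Properties as FinP
import Data.Nat.Properties as ℕP
open import Data.Product using (Σ; _×_; _,_; ∃)
open import Data.List using (List; []; _∷_; _++_; filter; length; lookup)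
open import Data.List.Membership.Propositional using (_∈_)
open import Data.List.Relation.Unary.Unique.Propositional using (Unique)
open import Data.List.Relation.Binary.Subset.Propositional using (_⊆_)
open import Data.Empty using (⊥)
open import Relation.Nullary using (Dec; yes; no; ¬_)
open import Relation.Nullary.Decidable using (map′; _×-dec_)
open import Relation.Binary.PropositionalEquality using (_≡_; _≢_; refl; cong; cong₂)

data Ty (nB : ℕ) : Set where
  base : Fin nB → Ty nB
  _×ᵗ_ : Ty nB → Ty nB → Ty nB
  _⇒_  : Ty nB → Ty nB → Ty nB

infixr 5 _⇒_
infixr 6 _×ᵗ_

nargs : ∀ {nB} → Ty nB → ℕ
nargs (base _)  = 0
nargs (_ ×ᵗ _)  = 0
nargs (_ ⇒ B)   = suc (nargs B)

module _ {nB : ℕ} where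
  _≟ᵗ_ : (A B : Ty nB) → Dec (A ≡ B)
  base a ≟ᵗ base b with a FinP.≟ b
  ... | yes refl = yes refl
  ... | no ne = no λ { refl → ne refl }
  base _ ≟ᵗ (_ ×ᵗ _) = no λ ()
  base _ ≟ᵗ (_ ⇒ _)  = no λ ()
  (_ ×ᵗ _) ≟ᵗ base _ = no λ ()
  (A ×ᵗ B) ≟ᵗ (C ×ᵗ D) with A ≟ᵗ C | B ≟ᵗ D
  ... | yes refl | yes refl = yes refl
  ... | no ne | _ = no λ { refl → ne refl }
  ... | yes _ | no ne = no λ { refl → ne refl }
  (_ ×ᵗ _) ≟ᵗ (_ ⇒ _) = no λ ()
  (_ ⇒ _) ≟ᵗ base _ = no λ ()
  (_ ⇒ _) ≟ᵗ (_ ×ᵗ _) = no λ ()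
  (A ⇒ B) ≟ᵗ (C ⇒ D) with A ≟ᵗ C | B ≟ᵗ D
  ... | yes refl | yes refl = yes refl
  ... | no ne | _ = no λ { refl → ne refl }
  ... | yes _ | no ne = no λ { refl → ne refl }

-- Signatures: function symbols F and constructors C (disjoint, being
-- elements of two different types), each with a simple type and arity.

record Signature : Set₁ where
  field
    nB   : ℕ
    Fun  : Set
    Con  : Set
    tyF  : Fun → Ty nB
    tyC  : Con → Ty nB
    arF  : Fun → ℕ
    arC  : Con → ℕ
    arF≤ : ∀ f → arF f ≤ nargs (tyF f)
    arC≤ : ∀ c → arC c ≤ nargs (tyC c)

module _ (S : Signature) where
  open Signature S

  -- Church-style variables: a name x ∈ ℕ together with its type A.
  TVar : Set
  TVar = ℕ × Ty nB

  _≟ᵛ_ : (a b : TVar) → Dec (a ≡ b)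
  (x , A) ≟ᵛ (y , B) =
    map′ (λ { (refl , refl) → refl }) (λ { refl → refl , refl })
         ((x ℕP.≟ y) ×-dec (A ≟ᵗ B))

  data Tm : Ty nB → Set where
    var  : (x : ℕ) (A : Ty nB) → Tm A
    fun  : (f : Fun) → Tm (tyF f)
    con  : (c : Con) → Tm (tyC c)
    app  : ∀ {A B} → Tm (A ⇒ B) → Tm A → Tm B
    pair : ∀ {A B} → Tm A → Tm B → Tm (A ×ᵗ B)
    -- let (x , y) = t in u   binds x : A and y : B in u
    letp : ∀ {A B C} (x y : ℕ) → Tm (A ×ᵗ B) → Tm C → Tm C

  notIn : (a b : TVar) → Dec (¬ (a ≡ b))
  notIn a b with a ≟ᵛ b
  ... | yes eq = no λ h → h eq
  ... | no ne  = yes ne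

  -- free variables (as a list of occurrences)
  fv : ∀ {A} → Tm A → List TVar
  fv (var x A) = (x , A) ∷ []
  fv (fun f) = []
  fv (con c) = []
  fv (app t u) = fv t ++ fv u
  fv (pair t u) = fv t ++ fv u
  fv (letp {A} {B} x y t u) =
    fv t ++ filter (λ z → notIn (x , A) z)
                   (filter (λ z → notIn (y , B) z) (fv u))

  Ground : ∀ {A} → Tm A → Set
  Ground t = fv t ≡ []

  Linear : ∀ {A} → Tm A → Set
  Linear t = Unique (fv t)

  Subst : Set
  Subst = (x : ℕ) (A : Ty nB) → Tm A

  _∖_ : Subst → TVar → Subst
  (θ ∖ (x , A)) z B with (z , B) ≟ᵛ (x , A)
  ... | yes _ = var z B
  ... | no _  = θ z B

  -- application of a substitution (bound variables shadow; only ever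
  -- applied with closed values or to let-free patterns, so capture-free)
  _⟪_⟫ : ∀ {A} → Subst → Tm A → Tm A
  θ ⟪ var x A ⟫ = θ x A
  θ ⟪ fun f ⟫ = fun f
  θ ⟪ con c ⟫ = con c
  θ ⟪ app t u ⟫ = app (θ ⟪ t ⟫) (θ ⟪ u ⟫)
  θ ⟪ pair t u ⟫ = pair (θ ⟪ t ⟫) (θ ⟪ u ⟫)
  θ ⟪ letp {A} {B} x y t u ⟫ = letp x y (θ ⟪ t ⟫) (((θ ∖ (x , A)) ∖ (y , B)) ⟪ u ⟫)

  _[_↦_] : ∀ {A B} → Tm B → ℕ → Tm A → Tm B
  _[_↦_] {A} u x v = (λ z C → sub z C) ⟪ u ⟫
    where
    sub : (z : ℕ) (C : Ty nB) → Tm C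
    sub z C with (z , C) ≟ᵛ (x , A)
    ... | yes refl = v
    ... | no _     = var z C

  data Pat : ∀ {A} → Tm A → Set
  data ConPatSpine : ∀ {A} → Tm A → Set

  data Pat where
    pvar : ∀ x A → Pat (var x A)
    pcon : ∀ {b} {t : Tm (base b)} → ConPatSpine t → Pat t

  data ConPatSpine where
    sc : ∀ c → ConPatSpine (con c)
    sa : ∀ {A B} {t : Tm (A ⇒ B)} {p : Tm A} →
         ConPatSpine t → Pat p → ConPatSpine (app t p)

  data FunPatSpine (f : Fun) : ℕ → ∀ {A} → Tm A → Set where
    sf : FunPatSpine f 0 (fun f)
    sa : ∀ {k A B} {t : Tm (A ⇒ B)} {p : Tm A} →
         FunPatSpine f k t → Pat p → FunPatSpine f (suc k) (app t p)

  data Value : ∀ {A} → Tm A → Set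
  data ConValSpine : ∀ {A} → Tm A → Set
  data FunValSpine (f : Fun) : ℕ → ∀ {A} → Tm A → Set

  data Value where
    vcon  : ∀ {A} {t : Tm A} → ConValSpine t → Value t
    vfun  : ∀ {A} {t : Tm A} f m → FunValSpine f m t → m < arF f → Value t
    vpair : ∀ {A B} {v : Tm A} {w : Tm B} → Value v → Value w → Value (pair v w)

  data ConValSpine where
    sc : ∀ c → ConValSpine (con c)
    sa : ∀ {A B} {t : Tm (A ⇒ B)} {v : Tm A} →
         ConValSpine t → Value v → ConValSpine (app t v)

  data FunValSpine f where
    sf : FunValSpine f 0 (fun f)
    sa : ∀ {k A B} {t : Tm (A ⇒ B)} {v : Tm A} →
         FunValSpine f k t → Value v → FunValSpine f (suc k) (app t v)

  record Equation : Set where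
    field
      ty      : Ty nB
      fn      : Fun
      lhs     : Tm ty
      rhs     : Tm ty
      lhsPat  : FunPatSpine fn (arF fn) lhs
      linear  : Linear lhs
      rhsVars : fv rhs ⊆ fv lhs
  open Equation public

  data InstanceOf : ∀ {A} → Tm A → Equation → Set where
    inst : ∀ (e : Equation) (θ : Subst) → InstanceOf (θ ⟪ lhs e ⟫) e

  -- a program: finite set (duplicate-free list) of equations whose
  -- left-hand sides defining the same f pairwise do not overlap
  record Program : Set where
    field
      eqs        : List Equation
      nonoverlap : ∀ i j → i ≢ j →
                   fn (lookup eqs i) ≡ fn (lookup eqs j) →
                   ∀ {A} (t : Tm A) →
                   ¬ (InstanceOf t (lookup eqs i) × InstanceOf t (lookup eqs j))
  open Program public

  -- Call-by-value reduction  →_P  (closure under evaluation contexts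
  --   E ::= [] | E t | t E | (E,t) | (t,E) | let (x,y) = E in t)

  data Step (P : Program) : ∀ {A} → Tm A → Tm A → Set where
    rule  : ∀ (e : Equation) → e ∈ eqs P → (θ : Subst) →
            (∀ x A → (x , A) ∈ fv (lhs e) → Value (θ x A)) →
            Step P (θ ⟪ lhs e ⟫) (θ ⟪ rhs e ⟫)
    letβ  : ∀ {A B C} (x y : ℕ) {v : Tm A} {w : Tm B} (u : Tm C) →
            Value v → Value w →
            Step P (letp x y (pair v w) u) ((u [ y ↦ w ]) [ x ↦ v ])
    appL  : ∀ {A B} {t t′ : Tm (A ⇒ B)} {u : Tm A} →
            Step P t t′ → Step P (app t u) (app t′ u)
    appR  : ∀ {A B} {t : Tm (A ⇒ B)} {u u′ : Tm A} →
            Step P u u′ → Step P (app t u) (app t u′)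
    pairL : ∀ {A B} {t t′ : Tm A} {u : Tm B} →
            Step P t t′ → Step P (pair t u) (pair t′ u)
    pairR : ∀ {A B} {t : Tm A} {u u′ : Tm B} →
            Step P u u′ → Step P (pair t u) (pair t u′)
    letE  : ∀ {A B C} (x y : ℕ) {t t′ : Tm (A ×ᵗ B)} {u : Tm C} →
            Step P t t′ → Step P (letp x y t u) (letp x y t′ u)

  data Steps (P : Program) : ℕ → ∀ {A} → Tm A → Tm A → Set where
    done : ∀ {A} {t : Tm A} → Steps P 0 t t
    more : ∀ {ℓ A} {t u v : Tm A} → Step P t u → Steps P ℓ u v → Steps P (suc ℓ) t v

module Submission where

-- The proof is the classical argument for rewriting systems with the
-- one-step diamond property.  Write t ⟶ u for a step of P.
--   1. Values are normal forms: a value has no redex and no redex inside.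
--   2. Root steps are deterministic.  A rule instance f v₁ ⋯ v_{ar f}
--      (a "redex") determines its equation, by non-overlapping, and its
--      matching substitution, because patterns are injective; hence its
--      contractum.  A let over a pair of values has only its β-step.
--   3. Diamond: two steps t ⟶ u₁ and t ⟶ u₂ either coincide or can be
--      joined by one further step on each side.  Steps are first located
--      (at the root, or inside one of the immediate subterms), and steps in
--      disjoint subterms commute.
--   4. From the diamond property, a step t ⟶ s out of a normalising
--      reduction t ⟶ᵏ v leaves a reduction s ⟶ᵏ⁻¹ v; induction on the
--      length of one reduction then gives the theorem.

open import Defs
open import Data.Nat using (ℕ; suc; _≤_)
open import Data.Nat.Properties using (<-irrefl; <⇒≤; ≤-refl)
import Data.Fin.Properties as Fin
open import Data.Product using (Σ; _×_; _,_; proj₁; proj₂)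
open import Data.Product.Properties using (,-injectiveʳ-UIP)
open import Data.Sum using (_⊎_; inj₁; inj₂)
open import Data.Empty using (⊥-elim)
open import Data.List using (List; _++_; lookup)
open import Data.List.Membership.Propositional using (_∈_)
open import Data.List.Membership.Propositional.Properties
  using (∈-++⁺ˡ; ∈-++⁺ʳ; ∈-++⁻; ∈-filter⁺)
open import Data.List.Relation.Unary.Any using (here; index)
open import Data.List.Relation.Unary.Any.Properties using (lookup-index)
open import Relation.Nullary using (¬_; yes; no)
open import Relation.Binary.PropositionalEquality
  using (_≡_; refl; sym; trans; cong; cong₂; subst)
import Axiom.UniquenessOfIdentityProofs as UIP

module UniqueNormalForms (S : Signature) (P : Program S) where
  open Signature S

  _⟶_ : ∀ {A} → Tm S A → Tm S A → Set
  t ⟶ u = Step S P t u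

  _⟦_⟧ : ∀ {A} → Subst S → Tm S A → Tm S A
  θ ⟦ t ⟧ = _⟪_⟫ S θ t

  -- Terms packed with their type, to compare terms whose types are only
  -- propositionally equal (e.g. instances of two different equations).
  Packed : Set
  Packed = Σ (Ty nB) (Tm S)

  ⌜_⌝ : ∀ {A} → Tm S A → Packed
  ⌜ t ⌝ = _ , t

  -- Types have decidable equality, so packing is injective.
  ⌜⌝-injective : ∀ {A} {t u : Tm S A} → ⌜ t ⌝ ≡ ⌜ u ⌝ → t ≡ u
  ⌜⌝-injective = ,-injectiveʳ-UIP (UIP.Decidable⇒UIP.≡-irrelevant _≟ᵗ_)

  _HoldsOn_ : (ℕ → Ty nB → Set) → List (TVar S) → Set
  Q HoldsOn xs = ∀ x A → (x , A) ∈ xs → Q x A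

  holdsOn-++ˡ : ∀ {Q} xs {ys} → Q HoldsOn (xs ++ ys) → Q HoldsOn xs
  holdsOn-++ˡ xs h x A x∈ = h x A (∈-++⁺ˡ x∈)

  holdsOn-++ʳ : ∀ {Q} xs {ys} → Q HoldsOn (xs ++ ys) → Q HoldsOn ys
  holdsOn-++ʳ xs h x A x∈ = h x A (∈-++⁺ʳ xs x∈)

  ValuesOn : Subst S → List (TVar S) → Set
  ValuesOn θ = (λ x A → Value S (θ x A)) HoldsOn_

  AgreeOn : Subst S → Subst S → List (TVar S) → Set
  AgreeOn θ₁ θ₂ = (λ x A → θ₁ x A ≡ θ₂ x A) HoldsOn_

  pattern-value : ∀ θ {A} {p : Tm S A} → Pat S p → ValuesOn θ (fv S p) →
                  Value S (θ ⟦ p ⟧)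
  con-pattern-value : ∀ θ {A} {p : Tm S A} → ConPatSpine S p →
                      ValuesOn θ (fv S p) → ConValSpine S (θ ⟦ p ⟧)
  pattern-value θ (pvar x A) vals = vals x A (here refl)
  pattern-value θ (pcon sp) vals = vcon (con-pattern-value θ sp vals)
  con-pattern-value θ (sc c) vals = sc c
  con-pattern-value θ (sa {t = t} sp p) vals =
    sa (con-pattern-value θ sp (holdsOn-++ˡ (fv S t) vals))
       (pattern-value θ p (holdsOn-++ʳ (fv S t) vals))

  fun-pattern-value : ∀ θ {f k A} {s : Tm S A} → FunPatSpine S f k s →
                      ValuesOn θ (fv S s) → FunValSpine S f k (θ ⟦ s ⟧)
  fun-pattern-value θ sf vals = sf
  fun-pattern-value θ (sa {t = t} sp p) vals =
    sa (fun-pattern-value θ sp (holdsOn-++ˡ (fv S t) vals))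
       (pattern-value θ p (holdsOn-++ʳ (fv S t) vals))

  app-injective : ∀ {A B} {t t′ : Tm S (A ⇒ B)} {u u′ : Tm S A} →
                  app t u ≡ app t′ u′ → (t ≡ t′) × (u ≡ u′)
  app-injective refl = refl , refl

  pattern-match-unique : ∀ θ₁ θ₂ {A} {p : Tm S A} → Pat S p →
                         θ₁ ⟦ p ⟧ ≡ θ₂ ⟦ p ⟧ → AgreeOn θ₁ θ₂ (fv S p)
  con-match-unique : ∀ θ₁ θ₂ {A} {p : Tm S A} → ConPatSpine S p →
                     θ₁ ⟦ p ⟧ ≡ θ₂ ⟦ p ⟧ → AgreeOn θ₁ θ₂ (fv S p)
  pattern-match-unique θ₁ θ₂ (pvar x A) eq .x .A (here refl) = eq
  pattern-match-unique θ₁ θ₂ (pcon sp) eq = con-match-unique θ₁ θ₂ sp eq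
  con-match-unique θ₁ θ₂ (sa {t = t} sp p) eq z C z∈ with app-injective eq | ∈-++⁻ (fv S t) z∈
  ... | eqₜ , _ | inj₁ z∈t = con-match-unique θ₁ θ₂ sp eqₜ z C z∈t
  ... | _ , eqₚ | inj₂ z∈p = pattern-match-unique θ₁ θ₂ p eqₚ z C z∈p

  fun-match-unique : ∀ θ₁ θ₂ {f k A} {s : Tm S A} → FunPatSpine S f k s →
                     θ₁ ⟦ s ⟧ ≡ θ₂ ⟦ s ⟧ → AgreeOn θ₁ θ₂ (fv S s)
  fun-match-unique θ₁ θ₂ (sa {t = t} sp p) eq z C z∈ with app-injective eq | ∈-++⁻ (fv S t) z∈
  ... | eqₜ , _ | inj₁ z∈t = fun-match-unique θ₁ θ₂ sp eqₜ z C z∈t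
  ... | _ , eqₚ | inj₂ z∈p = pattern-match-unique θ₁ θ₂ p eqₚ z C z∈p

  substitution-local : ∀ θ₁ θ₂ {A} (r : Tm S A) →
                       AgreeOn θ₁ θ₂ (fv S r) → θ₁ ⟦ r ⟧ ≡ θ₂ ⟦ r ⟧
  substitution-local θ₁ θ₂ (var x A) agree = agree x A (here refl)
  substitution-local θ₁ θ₂ (fun f) agree = refl
  substitution-local θ₁ θ₂ (con c) agree = refl
  substitution-local θ₁ θ₂ (app t u) agree =
    cong₂ app (substitution-local θ₁ θ₂ t (holdsOn-++ˡ (fv S t) agree))
              (substitution-local θ₁ θ₂ u (holdsOn-++ʳ (fv S t) agree))
  substitution-local θ₁ θ₂ (pair t u) agree =
    cong₂ pair (substitution-local θ₁ θ₂ t (holdsOn-++ˡ (fv S t) agree))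
               (substitution-local θ₁ θ₂ u (holdsOn-++ʳ (fv S t) agree))
  substitution-local θ₁ θ₂ (letp {A} {B} x y t u) agree =
    cong₂ (letp x y) (substitution-local θ₁ θ₂ t (holdsOn-++ˡ (fv S t) agree))
                     (substitution-local (bind θ₁) (bind θ₂) u agree-body)
    where
    bind : Subst S → Subst S
    bind θ = _∖_ S (_∖_ S θ (x , A)) (y , B)

    agree-body : AgreeOn (bind θ₁) (bind θ₂) (fv S u)
    agree-body z C z∈ with _≟ᵛ_ S (z , C) (y , B)
    ... | yes _ = refl
    ... | no z≢y with _≟ᵛ_ S (z , C) (x , A)
    ... | yes _ = refl
    ... | no z≢x = agree z C (∈-++⁺ʳ (fv S t)
        (∈-filter⁺ (notIn S (x , A))
          (∈-filter⁺ (notIn S (y , B)) z∈ (λ eq → z≢y (sym eq)))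
          (λ eq → z≢x (sym eq))))

  spine-head-unique : ∀ {f g k m A} {t : Tm S A} →
                      FunValSpine S f k t → FunValSpine S g m t → (f ≡ g) × (k ≡ m)
  spine-head-unique sf sf = refl , refl
  spine-head-unique (sa fs _) (sa gs _) with spine-head-unique fs gs
  ... | refl , refl = refl , refl

  spine-not-con : ∀ {f k A} {t : Tm S A} → FunValSpine S f k t → ¬ ConValSpine S t
  spine-not-con (sa fs _) (sa cs _) = spine-not-con fs cs

  -- Dropping the last argument of a spine of at most ar f arguments leaves
  -- an unsaturated application, i.e. a value; the argument is a value too.
  spine-function-value : ∀ {f k A B} {t : Tm S (A ⇒ B)} {u : Tm S A} →
                         FunValSpine S f k (app t u) → k ≤ arF f → Value S t
  spine-function-value (sa {k = j} fs _) j<ar = vfun _ j fs j<ar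

  spine-argument-value : ∀ {f k A B} {t : Tm S (A ⇒ B)} {u : Tm S A} →
                         FunValSpine S f k (app t u) → Value S u
  spine-argument-value (sa _ v) = v

  Redex : ∀ {A} → Tm S A → Set
  Redex t = Σ Fun λ f → FunValSpine S f (arF f) t

  instance-redex : (e : Equation S) (θ : Subst S) →
                   ValuesOn θ (fv S (lhs e)) → Redex (θ ⟦ lhs e ⟧)
  instance-redex e θ vals = fn e , fun-pattern-value θ (lhsPat e) vals

  instance-redex-at : ∀ {A} {t : Tm S A} (e : Equation S) {θ : Subst S} →
                      ValuesOn θ (fv S (lhs e)) → ⌜ θ ⟦ lhs e ⟧ ⌝ ≡ ⌜ t ⌝ → Redex t
  instance-redex-at e {θ} vals same = subst (λ p → Redex (proj₂ p)) same (instance-redex e θ vals)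

  pair-not-redex : ∀ {A B} {t : Tm S A} {u : Tm S B} → ¬ Redex (pair t u)
  pair-not-redex (_ , ())

  let-not-redex : ∀ {A B C} {x y : ℕ} {t : Tm S (A ×ᵗ B)} {u : Tm S C} → ¬ Redex (letp x y t u)
  let-not-redex (_ , ())

  -- A redex is saturated, hence not a value.
  redex-not-value : ∀ {A} {t : Tm S A} → Redex t → ¬ Value S t
  redex-not-value (f , fs) (vcon cs) = spine-not-con fs cs
  redex-not-value (f , fs) (vfun g m gs m<ar) with spine-head-unique fs gs
  ... | refl , refl = <-irrefl refl m<ar

  values-normal : ∀ {A} {t u : Tm S A} → Value S t → ¬ (t ⟶ u)
  values-normal v (rule e _ θ vals) = redex-not-value (instance-redex e θ vals) v
  values-normal (vcon ()) (letβ _ _ _ _ _)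
  values-normal (vfun _ _ () _) (letβ _ _ _ _ _)
  values-normal (vcon (sa cs _)) (appL s) = values-normal (vcon cs) s
  values-normal (vfun _ _ fs k<ar) (appL s) = values-normal (spine-function-value fs (<⇒≤ k<ar)) s
  values-normal (vcon (sa _ v)) (appR s) = values-normal v s
  values-normal (vfun _ _ fs _) (appR s) = values-normal (spine-argument-value fs) s
  values-normal (vpair v _) (pairL s) = values-normal v s
  values-normal (vpair _ w) (pairR s) = values-normal w s
  values-normal (vcon ()) (letE _ _ _)
  values-normal (vfun _ _ () _) (letE _ _ _)

  instance-unique : ∀ {e₁ e₂} → e₁ ∈ eqs P → e₂ ∈ eqs P → fn e₁ ≡ fn e₂ →
                    ∀ {A} {t : Tm S A} → InstanceOf S t e₁ → InstanceOf S t e₂ → e₁ ≡ e₂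
  instance-unique e₁∈ e₂∈ same-fn {t = t} i₁ i₂ with index e₁∈ Fin.≟ index e₂∈
  ... | yes same-index =
    trans (lookup-index e₁∈) (trans (cong (lookup (eqs P)) same-index) (sym (lookup-index e₂∈)))
  ... | no different-index = ⊥-elim (nonoverlap P (index e₁∈) (index e₂∈) different-index
      (trans (cong fn (sym (lookup-index e₁∈))) (trans same-fn (cong fn (lookup-index e₂∈))))
      t (subst (InstanceOf S t) (lookup-index e₁∈) i₁ , subst (InstanceOf S t) (lookup-index e₂∈) i₂))

  -- Two rule steps from the same term have the same result: the equation
  -- is unique, then so is the matching substitution on the left-hand side,
  -- and it fixes the right-hand side because fv (rhs e) ⊆ fv (lhs e).
  rule-deterministic : ∀ {e₁ e₂ θ₁ θ₂} → e₁ ∈ eqs P → e₂ ∈ eqs P →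
                       ValuesOn θ₁ (fv S (lhs e₁)) → ValuesOn θ₂ (fv S (lhs e₂)) →
                       ⌜ θ₁ ⟦ lhs e₁ ⟧ ⌝ ≡ ⌜ θ₂ ⟦ lhs e₂ ⟧ ⌝ → ⌜ θ₁ ⟦ rhs e₁ ⟧ ⌝ ≡ ⌜ θ₂ ⟦ rhs e₂ ⟧ ⌝
  rule-deterministic {e₁} {e₂} {θ₁} {θ₂} e₁∈ e₂∈ vals₁ vals₂ same-lhs
    with instance-unique e₁∈ e₂∈ same-fn (inst e₁ θ₁)
           (subst (λ p → InstanceOf S (proj₂ p) e₂) (sym same-lhs) (inst e₂ θ₂))
    where
    same-fn : fn e₁ ≡ fn e₂
    same-fn = proj₁ (spine-head-unique
      (subst (λ p → FunValSpine S (fn e₁) (arF (fn e₁)) (proj₂ p)) same-lhs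
             (proj₂ (instance-redex e₁ θ₁ vals₁)))
      (proj₂ (instance-redex e₂ θ₂ vals₂)))
  ... | refl = cong ⌜_⌝ (substitution-local θ₁ θ₂ (rhs e₁)
                  (λ x A x∈ → agree-lhs x A (rhsVars e₁ x∈)))
    where
    agree-lhs : AgreeOn θ₁ θ₂ (fv S (lhs e₁))
    agree-lhs = fun-match-unique θ₁ θ₂ (lhsPat e₁) (⌜⌝-injective same-lhs)

  -- The only step from a redex is its rule step: its immediate subterms are
  -- values, and it is neither a pair nor a let.
  redex-step-unique : ∀ {A} {t u : Tm S A} (e : Equation S) {θ} → e ∈ eqs P →
                      ValuesOn θ (fv S (lhs e)) → t ⟶ u →
                      ⌜ θ ⟦ lhs e ⟧ ⌝ ≡ ⌜ t ⌝ → ⌜ θ ⟦ rhs e ⟧ ⌝ ≡ ⌜ u ⌝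
  redex-step-unique e e∈ vals (rule _ e₂∈ _ vals₂) same = rule-deterministic e∈ e₂∈ vals vals₂ same
  redex-step-unique e e∈ vals (appL s) same =
    ⊥-elim (values-normal (spine-function-value (proj₂ (instance-redex-at e vals same)) ≤-refl) s)
  redex-step-unique e e∈ vals (appR s) same =
    ⊥-elim (values-normal (spine-argument-value (proj₂ (instance-redex-at e vals same))) s)
  redex-step-unique e e∈ vals (letβ _ _ _ _ _) same = ⊥-elim (let-not-redex (instance-redex-at e vals same))
  redex-step-unique e e∈ vals (pairL _) same = ⊥-elim (pair-not-redex (instance-redex-at e vals same))
  redex-step-unique e e∈ vals (pairR _) same = ⊥-elim (pair-not-redex (instance-redex-at e vals same))
  redex-step-unique e e∈ vals (letE _ _ _) same = ⊥-elim (let-not-redex (instance-redex-at e vals same))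

  letβ-unique : ∀ {A B C} {x y : ℕ} {v : Tm S A} {w : Tm S B} {u : Tm S C} {t r : Tm S C} →
                Value S v → Value S w → t ⟶ r → t ≡ letp x y (pair v w) u →
                r ≡ _[_↦_] S (_[_↦_] S u y w) x v
  letβ-unique vv wv (rule e _ θ vals) eq = ⊥-elim (let-not-redex (instance-redex-at e vals (cong ⌜_⌝ eq)))
  letβ-unique vv wv (letβ _ _ _ _ _) refl = refl
  letβ-unique vv wv (letE _ _ s) refl = ⊥-elim (values-normal (vpair vv wv) s)

  data Located : ∀ {A} → Tm S A → Tm S A → Set where
    root  : ∀ {A} {t u : Tm S A} → t ⟶ u → (∀ {u′} → t ⟶ u′ → u ≡ u′) → Located t u
    appL  : ∀ {A B} {t t′ : Tm S (A ⇒ B)} {u} → Located t t′ → Located (app t u) (app t′ u)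
    appR  : ∀ {A B} {t : Tm S (A ⇒ B)} {u u′} → Located u u′ → Located (app t u) (app t u′)
    pairL : ∀ {A B} {t t′ : Tm S A} {u : Tm S B} → Located t t′ → Located (pair t u) (pair t′ u)
    pairR : ∀ {A B} {t : Tm S A} {u u′ : Tm S B} → Located u u′ → Located (pair t u) (pair t u′)
    letE  : ∀ {A B C} (x y : ℕ) {t t′ : Tm S (A ×ᵗ B)} {u : Tm S C} →
            Located t t′ → Located (letp x y t u) (letp x y t′ u)

  locate : ∀ {A} {t u : Tm S A} → t ⟶ u → Located t u
  locate s@(rule e e∈ θ vals) = root s (λ s′ → ⌜⌝-injective (redex-step-unique e e∈ vals s′ refl))
  locate s@(letβ _ _ _ vv wv) = root s (λ s′ → sym (letβ-unique vv wv s′ refl))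
  locate (appL s) = appL (locate s)
  locate (appR s) = appR (locate s)
  locate (pairL s) = pairL (locate s)
  locate (pairR s) = pairR (locate s)
  locate (letE x y s) = letE x y (locate s)

  forget : ∀ {A} {t u : Tm S A} → Located t u → t ⟶ u
  forget (root s _) = s
  forget (appL l) = appL (forget l)
  forget (appR l) = appR (forget l)
  forget (pairL l) = pairL (forget l)
  forget (pairR l) = pairR (forget l)
  forget (letE x y l) = letE x y (forget l)

  Joinable : ∀ {A} → Tm S A → Tm S A → Set
  Joinable {A} u₁ u₂ = (u₁ ≡ u₂) ⊎ Σ (Tm S A) λ r → (u₁ ⟶ r) × (u₂ ⟶ r)

  joinable-in-context : ∀ {A B} (C : Tm S A → Tm S B) → (∀ {t u} → t ⟶ u → C t ⟶ C u) →
                        ∀ {u₁ u₂} → Joinable u₁ u₂ → Joinable (C u₁) (C u₂)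
  joinable-in-context C step (inj₁ refl) = inj₁ refl
  joinable-in-context C step (inj₂ (r , s₁ , s₂)) = inj₂ (C r , step s₁ , step s₂)

  -- Root steps are unique; steps in the same subterm are joined by
  -- induction; steps in different subterms commute.
  located-diamond : ∀ {A} {t u₁ u₂ : Tm S A} → Located t u₁ → Located t u₂ → Joinable u₁ u₂
  located-diamond (root _ only) l₂ = inj₁ (only (forget l₂))
  located-diamond l₁ (root _ only) = inj₁ (sym (only (forget l₁)))
  located-diamond (appL l₁) (appL l₂) = joinable-in-context (λ t → app t _) appL (located-diamond l₁ l₂)
  located-diamond (appL l₁) (appR l₂) = inj₂ (_ , appR (forget l₂) , appL (forget l₁))
  located-diamond (appR l₁) (appL l₂) = inj₂ (_ , appL (forget l₂) , appR (forget l₁))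
  located-diamond (appR l₁) (appR l₂) = joinable-in-context (app _) appR (located-diamond l₁ l₂)
  located-diamond (pairL l₁) (pairL l₂) = joinable-in-context (λ t → pair t _) pairL (located-diamond l₁ l₂)
  located-diamond (pairL l₁) (pairR l₂) = inj₂ (_ , pairR (forget l₂) , pairL (forget l₁))
  located-diamond (pairR l₁) (pairL l₂) = inj₂ (_ , pairL (forget l₂) , pairR (forget l₁))
  located-diamond (pairR l₁) (pairR l₂) = joinable-in-context (pair _) pairR (located-diamond l₁ l₂)
  located-diamond (letE x y l₁) (letE _ _ l₂) =
    joinable-in-context (λ t → letp x y t _) (letE x y) (located-diamond l₁ l₂)

  diamond : ∀ {A} {t u₁ u₂ : Tm S A} → t ⟶ u₁ → t ⟶ u₂ → Joinable u₁ u₂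
  diamond s₁ s₂ = located-diamond (locate s₁) (locate s₂)

  step-towards-value : ∀ {k A} {t s v : Tm S A} → Steps S P k t v → Value S v → t ⟶ s →
                       Σ ℕ λ k′ → (k ≡ suc k′) × Steps S P k′ s v
  step-towards-value done vv s = ⊥-elim (values-normal vv s)
  step-towards-value (more s₁ rest) vv s with diamond s₁ s
  ... | inj₁ refl = _ , refl , rest
  ... | inj₂ (r , s₁→r , s→r) with step-towards-value rest vv s₁→r
  ...   | k′ , refl , r→v = suc k′ , refl , more s→r r→v

  normalisation-unique : ∀ {m n A} {t v w : Tm S A} →
                         Steps S P m t v → Value S v → Steps S P n t w → Value S w →
                         (m ≡ n) × (v ≡ w)
  normalisation-unique done vv done wv = refl , refl
  normalisation-unique done vv (more s _) wv = ⊥-elim (values-normal vv s)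
  normalisation-unique (more s rest) vv t→w wv with step-towards-value t→w wv s
  ... | _ , refl , rest′ with normalisation-unique rest vv rest′ wv
  ...   | refl , refl = refl , refl

proposition4p1 : (S : Signature) (P : Program S)
                 {A : Ty (Signature.nB S)} (t v w : Tm S A) (m n : ℕ) →
                 Ground S t →
                 Steps S P m t v → Value S v →
                 Steps S P n t w → Value S w →
                 (m ≡ n) × (v ≡ w)
proposition4p1 S P t v w m n _ t→v vv t→w wv =
  UniqueNormalForms.normalisation-unique S P t→v vv t→w wv
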